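{- Let $\mathfrak{p}=(s,\pi)$ and $\mathfrak{p}'=(s',\pi')=(s^H,\pi^H)$ be cyclic plane permutations on $[n]$ such that $Par_{\pi}=Par_{\pi'}$ and $\pi$ and $\pi'$ differ only at the vertex $\nu$ (i.e. $\pi(i)=\pi'(i)$ for all $i\notin\nu$). Then there exists some $h$ such that $(s'_{\nu},\pi'_{\nu})=(s_{\nu}^h,\pi_{\nu}^h)$, and furthermore $(D_{\nu},Par_{\pi_{\nu}})=(D'_{\nu},Par_{\pi'_{\nu}})$.
   Context: A cyclic plane permutation on $[n]$ is a pair $\mathfrak{p}=(s,\pi)$ where $s=(s_0s_1\cdots s_{n-1})$ is an $n$-cycle (w.l.o.g. $s_0=1$) and $\pi$ is an arbitrary permutation on $[n]$; its diagonal is $D_{\mathfrak{p}}=s\circ\pi^{ -1}$. It is written in two-line form with top row $s_0,s_1,\dots,s_{n-1}$ and bottom row $\pi(s_0),\dots,\pi(s_{n-1})$; the diagonal-pairs are the pairs $(\pi(s_{i-1}),s_i)$ (cyclically), since $D_{\mathfrak{p}}(\pi(s_{i-1}))=s_i$. For a permutation $\pi$, $Par_{\pi}$ is the partition of $[n]$ into the cycles of $\pi$; its blocks are called vertices (of $\mathfrak{p}$) and their elements half edges. For a sequence $h=h_1\cdots h_{n-1}$ on $[n-1]$, $s^h=(s_0,s_{h_1},\dots,s_{h_{n-1}})$ and $\pi^h=D_{\mathfrak{p}}^{ -1}\circ s^h$, so $(s^h,\pi^h)$ has the same diagonal as $(s,\pi)$ and is obtained by permuting the diagonal-pairs of $(s,\pi)$.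 For a vertex $\nu$, the localization $\mathrm{loc}_\nu(\mathfrak{p})=(s_\nu,\pi_\nu)$ is the cyclic plane permutation obtained from the two-line form of $(s,\pi)$ by deleting all columns whose top entry is not a half edge of $\nu$; its diagonal is $D_\nu=s_\nu\circ\pi_\nu^{ -1}$. Primed notation $s'_\nu,\pi'_\nu,D'_\nu$ denotes the same objects for $\mathfrak{p}'$, and $(s_\nu^h,\pi_\nu^h)$ is the analogous action of a sequence $h$ on the localization. -}

module Defs where

open import Data.Nat using (ℕ; zero; suc)
open import Data.Fin using (Fin; _≟_)
open import Data.Fin.Subset using (Subset; _∈_; _∉_)
open import Data.Fin.Subset.Properties using (_∈?_)
open import Data.Fin.Permutation using (Permutation′; _⟨$⟩ʳ_; _⟨$⟩ˡ_)
open import Data.List using (List; []; _∷_; length; map; filter; reverse; drop; allFin; lookup)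
open import Data.Product using (Σ; ∃; _×_)
open import Relation.Nullary using (yes; no)
open import Relation.Binary.PropositionalEquality using (_≡_)
open import Function.Bundles using (_⇔_)
open import Data.List.Relation.Unary.Unique.Propositional using (Unique)
import Data.List.Membership.Propositional as ListMem

iter : {A : Set} → (A → A) → ℕ → A → A
iter f zero    x = x
iter f (suc k) x = f (iter f k x)

Reach : {n : ℕ} → (Fin n → Fin n) → Fin n → Fin n → Set
Reach f x y = ∃ λ k → iter f k x ≡ y

-- The cycle map of a cycle written as a word (a₀ a₁ … a_{m-1}):
-- aᵢ ↦ a_{i+1 mod m}, and every element not in the word is fixed.
-- go first x a r : image of x under the cycle map, scanning the word suffix (a ∷ r);
-- the last letter is sent to `first`.
go : {n : ℕ} → Fin n → Fin n → Fin n → List (Fin n) → Fin n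
go first x a [] with a ≟ x
... | yes _ = first
... | no  _ = x
go first x a (b ∷ r) with a ≟ x
... | yes _ = b
... | no  _ = go first x b r

cyc : {n : ℕ} → List (Fin n) → Fin n → Fin n
cyc []      x = x
cyc (a ∷ r) x = go a x a r

cycInv : {n : ℕ} → List (Fin n) → Fin n → Fin n
cycInv w = cyc (reverse w)

-- Action of a sequence h = h₁ ⋯ h_{m-1} (a permutation of [m-1]) on a cycle word
-- s = (s₀ s₁ … s_{m-1}):  s^h = (s₀ s_{h₁} … s_{h_{m-1}}).
-- Positions 1..m-1 are encoded as Fin (m-1), i.e. indices into the tail of the word.
actWord : {n : ℕ} → (w : List (Fin n)) → Permutation′ (length (drop 1 w)) → List (Fin n)
actWord []      h = []
actWord (a ∷ r) h = a ∷ map (λ i → lookup r (h ⟨$⟩ʳ i)) (allFin (length r))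

-- π^h = D^{-1} ∘ s^h, where D = s ∘ π^{-1}, so D^{-1} = π ∘ s^{-1}.
actPerm : {n : ℕ} → (w : List (Fin n)) → (Fin n → Fin n) → Permutation′ (length (drop 1 w))
        → Fin n → Fin n
actPerm w π h x = π (cycInv w (cyc (actWord w h) x))

diag : {n : ℕ} → List (Fin n) → (Fin n → Fin n) → Fin n → Fin n
diag w πinv x = cyc w (πinv x)

-- A cyclic plane permutation on [n]: the n-cycle s given by its word
-- (distinct entries, containing every element of [n]) and a permutation π.
record CPP (n : ℕ) : Set where
  field
    word  : List (Fin n)
    uniq  : Unique word
    cover : ∀ i → ListMem._∈_ i word
    perm  : Permutation′ n

-- ν is a vertex of π: a block of Par_π, i.e. ν is exactly the cycle of π through some x ∈ ν.
IsVertex : {n : ℕ} → Permutation′ n → Subset n → Set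
IsVertex π ν = ∃ λ x → x ∈ ν × (∀ y → (y ∈ ν ⇔ Reach (π ⟨$⟩ʳ_) x y))

-- Par_π = Par_π' : the partitions of [n] into cycles coincide.
SamePar : {n : ℕ} → Permutation′ n → Permutation′ n → Set
SamePar π π' = ∀ x y → (Reach (π ⟨$⟩ʳ_) x y ⇔ Reach (π' ⟨$⟩ʳ_) x y)

restr : {n : ℕ} → Subset n → (Fin n → Fin n) → Fin n → Fin n
restr ν f x with x ∈? ν
... | yes _ = f x
... | no  _ = x

-- Localization loc_ν(p) = (s_ν, π_ν): keep only the columns of the two-line form
-- whose top entry lies in ν.
locS : {n : ℕ} → Subset n → CPP n → List (Fin n)
locS ν p = filter (_∈? ν) (CPP.word p)

locπ : {n : ℕ} → Subset n → CPP n → Fin n → Fin n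
locπ ν p = restr ν (CPP.perm p ⟨$⟩ʳ_)

locπinv : {n : ℕ} → Subset n → CPP n → Fin n → Fin n
locπinv ν p = restr ν (CPP.perm p ⟨$⟩ˡ_)

locD : {n : ℕ} → Subset n → CPP n → Fin n → Fin n
locD ν p = diag (locS ν p) (locπinv ν p)

IsAction : {n : ℕ} → (p : CPP n) → Permutation′ (length (drop 1 (CPP.word p))) → CPP n → Set
IsAction p H p' = (CPP.word p' ≡ actWord (CPP.word p) H)
                × (∀ x → CPP.perm p' ⟨$⟩ʳ x ≡ actPerm (CPP.word p) (CPP.perm p ⟨$⟩ʳ_) H x)

module Submission where

-- For the theorem itself: the action preserves the diagonal D = s ∘ π⁻¹, so
-- s and s' agree wherever π and π' do, i.e. outside ν.  Since ν is closed under π⁻¹,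
-- D_ν is the first return of D to ν along s, and this does not depend on s inside ν; hence
-- D_ν = D'_ν.  The localized words have the same letters, giving h with s'_ν = s_ν^h, and
-- then π'_ν = D_ν⁻¹ ∘ s'_ν = π_ν^h.  Finally ν is a vertex of π' as well, and restricting
-- permutations to a common vertex keeps their orbits, so Par_{π_ν} = Par_{π'_ν}.

open import Defs
open import Data.Nat using (ℕ; zero; suc; _+_; _<_; _≤_; s≤s)
open import Data.Nat.Properties using (m≤n⇒∃[o]m+o≡n; +-suc; n<1+n; m≤m+n; m≤n+m)
open import Data.Fin using (Fin; _≟_; zero; suc; toℕ; cast)
open import Data.Fin.Properties using (cast-is-id; pigeonhole)
open import Data.Fin.Subset using (Subset; _∈_; _∉_)
open import Data.Fin.Subset.Properties using (_∈?_)
open import Data.Fin.Permutation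
  using (Permutation; Permutation′; permutation; _⟨$⟩ʳ_; _⟨$⟩ˡ_; inverseˡ; inverseʳ; _∘ₚ_; flip; cast-id; ↔⇒≡)
import Data.Fin.Permutation as Perm
open import Data.List using (List; []; _∷_; _++_; [_]; length; drop; filter; reverse; map; lookup; allFin; tabulate)
open import Data.List.Properties
  using (filter-++; filter-accept; ++-assoc; ++-identityʳ; reverse-++; reverse-involutive; map-cong; map-tabulate; tabulate-lookup)
open import Data.List.Relation.Unary.Any using (here; there; index)
open import Data.List.Relation.Unary.Any.Properties using (lookup-index)
import Data.List.Membership.Propositional as List
open import Data.List.Membership.Propositional.Properties using (∈-∃++; ∈-lookup; ∈-++⁺ʳ; ∈-filter⁺; ∈-filter⁻)
import Data.List.Membership.DecPropositional as DecMembership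
open import Data.List.Relation.Binary.Subset.Propositional using (_⊆_)
open import Data.List.Relation.Unary.Unique.Propositional using (Unique)
open import Data.List.Relation.Unary.Unique.Propositional.Properties using (filter⁺; drop⁺; Unique[x∷xs]⇒x∉xs)
open import Data.List.Relation.Binary.Permutation.Propositional using (_↭_; ↭⇒↭ₛ; ↭-sym)
open import Data.List.Relation.Binary.Permutation.Propositional.Properties using (++-comm; ↭-reverse; ∷↭∷ʳ; ∈-resp-↭; ↭-length)
import Data.List.Relation.Binary.Permutation.Setoid.Properties as SetoidPerm
open import Data.Product using (∃; _×_; _,_; proj₁; proj₂)
open import Data.Empty using (⊥-elim)
open import Relation.Nullary using (yes; no)
open import Relation.Binary.PropositionalEquality hiding ([_])
open import Function.Bundles using (_⇔_; mk⇔; Equivalence)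
import Function.Properties.Equivalence as ⇔

private
  variable
    n : ℕ

unique-↭ : {xs ys : List (Fin n)} → xs ↭ ys → Unique xs → Unique ys
unique-↭ {n} p = SetoidPerm.Unique-resp-↭ (setoid (Fin n)) (↭⇒↭ₛ p)

unique-reverse : {xs : List (Fin n)} → Unique xs → Unique (reverse xs)
unique-reverse {xs = xs} = unique-↭ (↭-sym (↭-reverse xs))

unique-∉-prefix : ∀ (xs : List (Fin n)) c ys → Unique (xs ++ c ∷ ys) → c List.∉ xs
unique-∉-prefix xs c ys u c∈xs =
  Unique[x∷xs]⇒x∉xs (unique-↭ (++-comm xs (c ∷ ys)) u) (∈-++⁺ʳ ys c∈xs)

headOr : Fin n → List (Fin n) → Fin n
headOr d []      = d
headOr d (x ∷ _) = x

go-self : ∀ (f x : Fin n) r → go f x x r ≡ headOr f r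
go-self f x [] with x ≟ x
... | yes _  = refl
... | no x≢x = ⊥-elim (x≢x refl)
go-self f x (_ ∷ _) with x ≟ x
... | yes _  = refl
... | no x≢x = ⊥-elim (x≢x refl)

go-past : ∀ (f x c : Fin n) q r → x List.∉ c ∷ q → go f x c (q ++ x ∷ r) ≡ headOr f r
go-past f x c [] r x∉ with c ≟ x
... | yes c≡x = ⊥-elim (x∉ (here (sym c≡x)))
... | no _    = go-self f x r
go-past f x c (d ∷ q) r x∉ with c ≟ x
... | yes c≡x = ⊥-elim (x∉ (here (sym c≡x)))
... | no _    = go-past f x d q r (λ m → x∉ (there m))

go-absent : ∀ (f x c : Fin n) q → x List.∉ c ∷ q → go f x c q ≡ x
go-absent f x c [] x∉ with c ≟ x
... | yes c≡x = ⊥-elim (x∉ (here (sym c≡x)))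
... | no _    = refl
go-absent f x c (d ∷ q) x∉ with c ≟ x
... | yes c≡x = ⊥-elim (x∉ (here (sym c≡x)))
... | no _    = go-absent f x d q (λ m → x∉ (there m))

go-snoc : ∀ (a b x c : Fin n) q → x ≢ a → go a x c q ≡ go b x c (q ++ [ a ])
go-snoc a b x c [] x≢a with c ≟ x
... | yes _ = refl
... | no _ with a ≟ x
...   | yes a≡x = ⊥-elim (x≢a (sym a≡x))
...   | no _    = refl
go-snoc a b x c (d ∷ q) x≢a with c ≟ x
... | yes _ = refl
... | no _  = go-snoc a b x d q x≢a

cyc-absent : ∀ (w : List (Fin n)) x → x List.∉ w → cyc w x ≡ x
cyc-absent []      x _  = refl
cyc-absent (a ∷ r) x x∉ = go-absent a x a r x∉

cyc-rotate-head : ∀ (a : Fin n) r → Unique (a ∷ r) → ∀ x → cyc (a ∷ r) x ≡ cyc (r ++ [ a ]) x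
cyc-rotate-head a []      _ x = refl
cyc-rotate-head a (b ∷ r) u x with a ≟ x
... | yes refl = sym (go-past b a b r [] (Unique[x∷xs]⇒x∉xs u))
... | no a≢x   = go-snoc a b x b r (λ e → a≢x (sym e))

cyc-rotate : ∀ (u v : List (Fin n)) → Unique (u ++ v) → ∀ x → cyc (u ++ v) x ≡ cyc (v ++ u) x
cyc-rotate []      v _  x = cong (λ w → cyc w x) (sym (++-identityʳ v))
cyc-rotate (a ∷ u) v uq x = begin
  cyc (a ∷ u ++ v) x          ≡⟨ cyc-rotate-head a (u ++ v) uq x ⟩
  cyc ((u ++ v) ++ [ a ]) x   ≡⟨ cong (λ w → cyc w x) (++-assoc u v [ a ]) ⟩
  cyc (u ++ (v ++ [ a ])) x   ≡⟨ cyc-rotate u (v ++ [ a ]) uq′ x ⟩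
  cyc ((v ++ [ a ]) ++ u) x   ≡⟨ cong (λ w → cyc w x) (++-assoc v [ a ] u) ⟩
  cyc (v ++ a ∷ u) x          ∎
  where
  open ≡-Reasoning
  uq′ : Unique (u ++ (v ++ [ a ]))
  uq′ = subst Unique (++-assoc u v [ a ]) (unique-↭ (∷↭∷ʳ a (u ++ v)) uq)

-- The same holds for the inverse cycle, since reversal turns rotations into rotations.
cycInv-rotate : ∀ (u v : List (Fin n)) → Unique (u ++ v) → ∀ x → cycInv (u ++ v) x ≡ cycInv (v ++ u) x
cycInv-rotate u v uq x = begin
  cyc (reverse (u ++ v)) x         ≡⟨ cong (λ w → cyc w x) (reverse-++ u v) ⟩
  cyc (reverse v ++ reverse u) x   ≡⟨ cyc-rotate (reverse v) (reverse u) uq′ x ⟩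
  cyc (reverse u ++ reverse v) x   ≡⟨ cong (λ w → cyc w x) (sym (reverse-++ v u)) ⟩
  cyc (reverse (v ++ u)) x         ∎
  where
  open ≡-Reasoning
  uq′ : Unique (reverse v ++ reverse u)
  uq′ = subst Unique (reverse-++ u v) (unique-reverse uq)

cycInv-head : ∀ (x : Fin n) r → Unique (x ∷ r) → cycInv (x ∷ r) (headOr x r) ≡ x
cycInv-head x []      _ = go-self x x []
cycInv-head x (y ∷ r) u = begin
  cyc (reverse (x ∷ y ∷ r)) y           ≡⟨ cong (λ w → cyc w y) reversed ⟩
  cyc (reverse r ++ y ∷ x ∷ []) y       ≡⟨ cyc-rotate (reverse r) (y ∷ x ∷ []) u′ y ⟩
  cyc (y ∷ x ∷ reverse r) y             ≡⟨ go-self y y (x ∷ reverse r) ⟩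
  x                                     ∎
  where
  open ≡-Reasoning
  reversed : reverse (x ∷ y ∷ r) ≡ reverse r ++ y ∷ x ∷ []
  reversed = reverse-++ (x ∷ y ∷ []) r
  u′ : Unique (reverse r ++ y ∷ x ∷ [])
  u′ = subst Unique reversed (unique-reverse u)

cycInv-cyc : ∀ (w : List (Fin n)) → Unique w → ∀ x → cycInv w (cyc w x) ≡ x
cycInv-cyc w uw x with DecMembership._∈?_ _≟_ x w
... | no x∉ = begin
  cycInv w (cyc w x) ≡⟨ cong (cycInv w) (cyc-absent w x x∉) ⟩
  cycInv w x         ≡⟨ cyc-absent (reverse w) x (λ m → x∉ (∈-resp-↭ (↭-reverse w) m)) ⟩
  x                  ∎
  where open ≡-Reasoning
... | yes x∈ with ∈-∃++ x∈
...   | u , v , refl = begin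
  cycInv (u ++ x ∷ v) (cyc (u ++ x ∷ v) x)     ≡⟨ cycInv-rotate u (x ∷ v) uw _ ⟩
  cycInv (x ∷ v ++ u) (cyc (u ++ x ∷ v) x)     ≡⟨ cong (cycInv (x ∷ v ++ u)) (cyc-rotate u (x ∷ v) uw x) ⟩
  cycInv (x ∷ v ++ u) (cyc (x ∷ v ++ u) x)     ≡⟨ cong (cycInv (x ∷ v ++ u)) (go-self x x (v ++ u)) ⟩
  cycInv (x ∷ v ++ u) (headOr x (v ++ u))      ≡⟨ cycInv-head x (v ++ u) (unique-↭ (++-comm u (x ∷ v)) uw) ⟩
  x                                            ∎
  where open ≡-Reasoning

cyc-cycInv : ∀ (w : List (Fin n)) → Unique w → ∀ y → cyc w (cycInv w y) ≡ y
cyc-cycInv w uw y =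
  subst (λ v → cyc v (cycInv w y) ≡ y) (reverse-involutive w)
        (cycInv-cyc (reverse w) (unique-reverse uw) y)

lookup-injective : ∀ (xs : List (Fin n)) → Unique xs → ∀ i j → lookup xs i ≡ lookup xs j → i ≡ j
lookup-injective (x ∷ xs) u       zero    zero    _ = refl
lookup-injective (x ∷ xs) u       zero    (suc j) e = ⊥-elim (Unique[x∷xs]⇒x∉xs u (subst (List._∈ xs) (sym e) (∈-lookup j)))
lookup-injective (x ∷ xs) u       (suc i) zero    e = ⊥-elim (Unique[x∷xs]⇒x∉xs u (subst (List._∈ xs) e (∈-lookup i)))
lookup-injective (x ∷ xs) u       (suc i) (suc j) e = cong suc (lookup-injective xs (drop⁺ 1 u) i j e)

map-lookup-cast : ∀ (xs : List (Fin n)) m (eq : m ≡ length xs) → map (λ i → lookup xs (cast eq i)) (allFin m) ≡ xs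
map-lookup-cast xs m refl = begin
  map (λ i → lookup xs (cast refl i)) (allFin (length xs)) ≡⟨ map-cong (λ i → cong (lookup xs) (cast-is-id refl i)) _ ⟩
  map (lookup xs) (tabulate (λ i → i))                      ≡⟨ map-tabulate (λ i → i) (lookup xs) ⟩
  tabulate (lookup xs)                                      ≡⟨ tabulate-lookup xs ⟩
  xs                                                        ∎
  where open ≡-Reasoning

reindex : ∀ (xs ys : List (Fin n)) → Unique xs → Unique ys → xs ⊆ ys → ys ⊆ xs →
          ∃ λ (h : Permutation′ (length xs)) → map (λ i → lookup xs (h ⟨$⟩ʳ i)) (allFin (length xs)) ≡ ys
reindex xs ys uxs uys xs⊆ys ys⊆xs =
  h , trans (map-cong (λ i → to-xs-correct (cast eq i)) (allFin (length xs))) (map-lookup-cast ys (length xs) eq)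
  where
  to-ys : Fin (length xs) → Fin (length ys)
  to-ys i = index (xs⊆ys (∈-lookup i))
  to-xs : Fin (length ys) → Fin (length xs)
  to-xs j = index (ys⊆xs (∈-lookup j))
  to-ys-correct : ∀ i → lookup ys (to-ys i) ≡ lookup xs i
  to-ys-correct i = sym (lookup-index (xs⊆ys (∈-lookup i)))
  to-xs-correct : ∀ j → lookup xs (to-xs j) ≡ lookup ys j
  to-xs-correct j = sym (lookup-index (ys⊆xs (∈-lookup j)))
  positions : Permutation (length xs) (length ys)
  positions = permutation to-ys to-xs
    (λ j → lookup-injective ys uys _ _ (trans (to-ys-correct (to-xs j)) (to-xs-correct j)))
    (λ i → lookup-injective xs uxs _ _ (trans (to-xs-correct (to-ys i)) (to-ys-correct i)))
  eq : length xs ≡ length ys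
  eq = ↔⇒≡ positions
  h : Permutation′ (length xs)
  h = cast-id eq ∘ₚ flip positions

-- A duplicate-free word t' with the same letters as t has the same cycle as some
-- reordering t^h of t: rotate t' to start with the first letter of t, then reindex the rest.
cyc-reorder : ∀ (t t' : List (Fin n)) → Unique t → Unique t' → t ⊆ t' → t' ⊆ t →
              ∃ λ (h : Permutation′ (length (drop 1 t))) → ∀ x → cyc t' x ≡ cyc (actWord t h) x
cyc-reorder [] []       _ _ _ _ = Perm.id , λ _ → refl
cyc-reorder [] (a ∷ t') _ _ _ t'⊆t with t'⊆t (here refl)
... | ()
cyc-reorder (a ∷ r) t' ut ut' t⊆t' t'⊆t with ∈-∃++ (t⊆t' (here refl))
... | u , v , refl with reindex r (v ++ u) (drop⁺ 1 ut) (drop⁺ 1 rotated-unique) r⊆vu vu⊆r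
  where
  rotation : u ++ a ∷ v ↭ a ∷ v ++ u
  rotation = ++-comm u (a ∷ v)
  rotated-unique : Unique (a ∷ v ++ u)
  rotated-unique = unique-↭ rotation ut'
  r⊆vu : r ⊆ v ++ u
  r⊆vu y∈r with ∈-resp-↭ rotation (t⊆t' (there y∈r))
  ... | here refl = ⊥-elim (Unique[x∷xs]⇒x∉xs ut y∈r)
  ... | there m   = m
  vu⊆r : v ++ u ⊆ r
  vu⊆r y∈vu with t'⊆t (∈-resp-↭ (↭-sym rotation) (there y∈vu))
  ... | here refl = ⊥-elim (Unique[x∷xs]⇒x∉xs rotated-unique y∈vu)
  ... | there m   = m
... | h , reindexed = h , λ x → trans (cyc-rotate u (a ∷ v) ut' x) (cong (λ w → cyc (a ∷ w) x) (sym reindexed))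

-- Localizing a cycle to ν yields its first-return map to ν.

module _ {n : ℕ} (ν : Subset n) where

  firstReturn : (Fin n → Fin n) → ℕ → Fin n → Fin n
  firstReturn f zero    y = y
  firstReturn f (suc k) y with y ∈? ν
  ... | yes _ = y
  ... | no _  = firstReturn f k (f y)

  firstReturn-cong : ∀ (f g : Fin n → Fin n) → (∀ y → y ∉ ν → f y ≡ g y) →
                     ∀ k y → firstReturn f k y ≡ firstReturn g k y
  firstReturn-cong f g f≡g zero    y = refl
  firstReturn-cong f g f≡g (suc k) y with y ∈? ν
  ... | yes _ = refl
  ... | no y∉ rewrite f≡g y y∉ = firstReturn-cong f g f≡g k (g y)

  firstReturn-walk : ∀ (z : Fin n) q r k → Unique (z ∷ q ++ r) → z ∈ ν → length r < k →
                     firstReturn (cyc (z ∷ q ++ r)) k (headOr z r) ≡ headOr z (filter (_∈? ν) r)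
  firstReturn-walk z q []      (suc k) _  z∈ν _ with z ∈? ν
  ... | yes _  = refl
  ... | no z∉ν = ⊥-elim (z∉ν z∈ν)
  firstReturn-walk z q (c ∷ r) (suc k) uq z∈ν (s≤s r<k) with c ∈? ν
  ... | yes _ = refl
  ... | no _  = begin
    firstReturn (cyc (z ∷ q ++ c ∷ r)) k (cyc (z ∷ q ++ c ∷ r) c) ≡⟨ cong (firstReturn _ k) (go-past z c z q r c∉zq) ⟩
    firstReturn (cyc (z ∷ q ++ c ∷ r)) k (headOr z r)             ≡⟨ cong (λ w → firstReturn (cyc (z ∷ w)) k (headOr z r)) reassoc ⟩
    firstReturn (cyc (z ∷ (q ++ [ c ]) ++ r)) k (headOr z r)      ≡⟨ firstReturn-walk z (q ++ [ c ]) r k uq′ z∈ν r<k ⟩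
    headOr z (filter (_∈? ν) r)                                   ∎
    where
    open ≡-Reasoning
    reassoc : q ++ c ∷ r ≡ (q ++ [ c ]) ++ r
    reassoc = sym (++-assoc q [ c ] r)
    uq′ : Unique (z ∷ (q ++ [ c ]) ++ r)
    uq′ = subst (λ w → Unique (z ∷ w)) reassoc uq
    c∉zq : c List.∉ z ∷ q
    c∉zq = unique-∉-prefix (z ∷ q) c r uq

  -- Filtering commutes with concatenation, so localized cycles are also invariant under rotation.
  cyc-filter-rotate : ∀ (u v : List (Fin n)) → Unique (u ++ v) →
                      ∀ x → cyc (filter (_∈? ν) (u ++ v)) x ≡ cyc (filter (_∈? ν) (v ++ u)) x
  cyc-filter-rotate u v uq x = begin
    cyc (filter (_∈? ν) (u ++ v)) x                     ≡⟨ cong (λ w → cyc w x) (filter-++ (_∈? ν) u v) ⟩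
    cyc (filter (_∈? ν) u ++ filter (_∈? ν) v) x        ≡⟨ cyc-rotate (filter (_∈? ν) u) (filter (_∈? ν) v) filtered-unique x ⟩
    cyc (filter (_∈? ν) v ++ filter (_∈? ν) u) x        ≡⟨ cong (λ w → cyc w x) (sym (filter-++ (_∈? ν) v u)) ⟩
    cyc (filter (_∈? ν) (v ++ u)) x                     ∎
    where
    open ≡-Reasoning
    filtered-unique : Unique (filter (_∈? ν) u ++ filter (_∈? ν) v)
    filtered-unique = subst Unique (filter-++ (_∈? ν) u v) (filter⁺ (_∈? ν) uq)

  cyc-filter-head : ∀ (z : Fin n) r k → Unique (z ∷ r) → z ∈ ν → length r < k →
                    cyc (filter (_∈? ν) (z ∷ r)) z ≡ firstReturn (cyc (z ∷ r)) k (cyc (z ∷ r) z)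
  cyc-filter-head z r k uq z∈ν r<k = begin
    cyc (filter (_∈? ν) (z ∷ r)) z              ≡⟨ cong (λ w → cyc w z) (filter-accept (_∈? ν) z∈ν) ⟩
    cyc (z ∷ filter (_∈? ν) r) z                ≡⟨ go-self z z (filter (_∈? ν) r) ⟩
    headOr z (filter (_∈? ν) r)                 ≡⟨ firstReturn-walk z [] r k uq z∈ν r<k ⟨
    firstReturn (cyc (z ∷ r)) k (headOr z r)    ≡⟨ cong (firstReturn (cyc (z ∷ r)) k) (go-self z z r) ⟨
    firstReturn (cyc (z ∷ r)) k (cyc (z ∷ r) z) ∎
    where open ≡-Reasoning

  cyc-filter : ∀ (w : List (Fin n)) z k → Unique w → z List.∈ w → z ∈ ν → length w ≤ k →
               cyc (filter (_∈? ν) w) z ≡ firstReturn (cyc w) k (cyc w z)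
  cyc-filter w z k uw z∈w z∈ν w≤k with ∈-∃++ z∈w
  ... | u , v , refl = begin
    cyc (filter (_∈? ν) (u ++ z ∷ v)) z                    ≡⟨ cyc-filter-rotate u (z ∷ v) uw z ⟩
    cyc (filter (_∈? ν) (z ∷ v ++ u)) z                    ≡⟨ cyc-filter-head z (v ++ u) k (unique-↭ rotation uw) z∈ν r<k ⟩
    firstReturn (cyc (z ∷ v ++ u)) k (cyc (z ∷ v ++ u) z)  ≡⟨ cong (firstReturn _ k) (cyc-rotate u (z ∷ v) uw z) ⟨
    firstReturn (cyc (z ∷ v ++ u)) k (cyc (u ++ z ∷ v) z)  ≡⟨ firstReturn-cong _ _ (λ y _ → cyc-rotate u (z ∷ v) uw y) k _ ⟨
    firstReturn (cyc (u ++ z ∷ v)) k (cyc (u ++ z ∷ v) z)  ∎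
    where
    open ≡-Reasoning
    rotation : u ++ z ∷ v ↭ z ∷ v ++ u
    rotation = ++-comm u (z ∷ v)
    r<k : length (v ++ u) < k
    r<k = subst (_≤ k) (↭-length rotation) w≤k

iter-+ : ∀ {A : Set} (f : A → A) a b x → iter f (a + b) x ≡ iter f a (iter f b x)
iter-+ f zero    b x = refl
iter-+ f (suc a) b x = cong f (iter-+ f a b x)

iter-injective : ∀ {A : Set} (f : A → A) → (∀ {x y} → f x ≡ f y → x ≡ y) →
                 ∀ a {x y} → iter f a x ≡ iter f a y → x ≡ y
iter-injective f f-inj zero    e = e
iter-injective f f-inj (suc a) e = iter-injective f f-inj a (f-inj e)

perm-injective : ∀ (P : Permutation′ n) {x y} → P ⟨$⟩ʳ x ≡ P ⟨$⟩ʳ y → x ≡ y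
perm-injective P e = trans (sym (inverseˡ P)) (trans (cong (P ⟨$⟩ˡ_) e) (inverseˡ P))

-- Every point lies on a cycle of a permutation of a finite set: among the n+1 points
-- x, πx, …, πⁿx two coincide (pigeonhole), and π is injective.
perm-period : ∀ (P : Permutation′ n) x → ∃ λ N → iter (P ⟨$⟩ʳ_) (suc N) x ≡ x
perm-period {n} P x with pigeonhole (n<1+n n) (λ (i : Fin (suc n)) → iter (P ⟨$⟩ʳ_) (toℕ i) x)
... | i , j , i<j , πⁱx≡πʲx with m≤n⇒∃[o]m+o≡n i<j
...   | d , i+1+d≡j = d , iter-injective π (perm-injective P) (toℕ i) (begin
  iter π (toℕ i) (iter π (suc d) x) ≡⟨ iter-+ π (toℕ i) (suc d) x ⟨
  iter π (toℕ i + suc d) x          ≡⟨ cong (λ m → iter π m x) (trans (+-suc (toℕ i) d) i+1+d≡j) ⟩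
  iter π (toℕ j) x                  ≡⟨ πⁱx≡πʲx ⟨
  iter π (toℕ i) x                  ∎)
  where
  open ≡-Reasoning
  π : Fin n → Fin n
  π = P ⟨$⟩ʳ_

perm-inverse-iterate : ∀ (P : Permutation′ n) x → ∃ λ N → P ⟨$⟩ˡ x ≡ iter (P ⟨$⟩ʳ_) N x
perm-inverse-iterate P x with perm-period P x
... | N , πᴺ⁺¹x≡x = N , trans (cong (P ⟨$⟩ˡ_) (sym πᴺ⁺¹x≡x)) (inverseˡ P)

vertex-closed : ∀ (P : Permutation′ n) ν → IsVertex P ν → ∀ y → y ∈ ν → P ⟨$⟩ʳ y ∈ ν
vertex-closed P ν (x , _ , orbit) y y∈ν with Equivalence.to (orbit y) y∈ν
... | k , πᵏx≡y = Equivalence.from (orbit _) (suc k , cong (P ⟨$⟩ʳ_) πᵏx≡y)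

vertex-closed⁻¹ : ∀ (P : Permutation′ n) ν → IsVertex P ν → ∀ y → y ∈ ν → P ⟨$⟩ˡ y ∈ ν
vertex-closed⁻¹ P ν (x , _ , orbit) y y∈ν with Equivalence.to (orbit y) y∈ν | perm-inverse-iterate P y
... | k , πᵏx≡y | N , π⁻¹y≡πᴺy = Equivalence.from (orbit _)
  (N + k , trans (iter-+ (P ⟨$⟩ʳ_) N k x) (trans (cong (iter (P ⟨$⟩ʳ_) N) πᵏx≡y) (sym π⁻¹y≡πᴺy)))

vertex-samePar : ∀ (P P' : Permutation′ n) ν → SamePar P P' → IsVertex P ν → IsVertex P' ν
vertex-samePar P P' ν same (x , x∈ν , orbit) = x , x∈ν , λ y → ⇔.trans (orbit y) (same x y)

restr-in : ∀ (ν : Subset n) f x → x ∈ ν → restr ν f x ≡ f x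
restr-in ν f x x∈ν with x ∈? ν
... | yes _  = refl
... | no x∉ν = ⊥-elim (x∉ν x∈ν)

reach-restr : ∀ (ν : Subset n) f → (∀ z → z ∈ ν → f z ∈ ν) →
              ∀ x y → x ∈ ν → Reach (restr ν f) x y ⇔ Reach f x y
reach-restr ν f closed x y x∈ν = mk⇔ (λ (k , e) → k , trans (sym (same-iterates k .proj₁)) e)
                                     (λ (k , e) → k , trans (same-iterates k .proj₁) e)
  where
  same-iterates : ∀ k → (iter (restr ν f) k x ≡ iter f k x) × (iter f k x ∈ ν)
  same-iterates zero    = refl , x∈ν
  same-iterates (suc k) with same-iterates k
  ... | e , fᵏx∈ν = trans (cong (restr ν f) e) (restr-in ν f _ fᵏx∈ν) , closed _ fᵏx∈ν

restr-samePar : ∀ (P P' : Permutation′ n) ν → SamePar P P' → IsVertex P ν →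
                ∀ x y → x ∈ ν → Reach (restr ν (P ⟨$⟩ʳ_)) x y ⇔ Reach (restr ν (P' ⟨$⟩ʳ_)) x y
restr-samePar P P' ν same vertex x y x∈ν =
  ⇔.trans (reach-restr ν (P ⟨$⟩ʳ_) (vertex-closed P ν vertex) x y x∈ν)
          (⇔.trans (same x y) (⇔.sym (reach-restr ν (P' ⟨$⟩ʳ_) (vertex-closed P' ν vertex') x y x∈ν)))
  where
  vertex' : IsVertex P' ν
  vertex' = vertex-samePar P P' ν same vertex

module _ {n : ℕ} (ν : Subset n) (p : CPP n) where

  locS-unique : Unique (locS ν p)
  locS-unique = filter⁺ (_∈? ν) (CPP.uniq p)

  locS-inside : ∀ {y} → y List.∈ locS ν p → y ∈ ν
  locS-inside {y} y∈t = proj₂ (∈-filter⁻ (_∈? ν) {xs = CPP.word p} y∈t)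

  locS-complete : ∀ {y} → y ∈ ν → y List.∈ locS ν p
  locS-complete {y} y∈ν = ∈-filter⁺ (_∈? ν) (CPP.cover p y) y∈ν

  locD-inside : ∀ x → x ∈ ν → locD ν p x ≡ cyc (locS ν p) (CPP.perm p ⟨$⟩ˡ x)
  locD-inside x x∈ν = cong (cyc (locS ν p)) (restr-in ν (CPP.perm p ⟨$⟩ˡ_) x x∈ν)

  locD-firstReturn : IsVertex (CPP.perm p) ν → ∀ k → length (CPP.word p) ≤ k →
                     ∀ x → x ∈ ν → locD ν p x ≡ firstReturn ν (cyc (CPP.word p)) k (diag (CPP.word p) (CPP.perm p ⟨$⟩ˡ_) x)
  locD-firstReturn vertex k w≤k x x∈ν =
    trans (locD-inside x x∈ν)
          (cyc-filter ν (CPP.word p) _ k (CPP.uniq p) (CPP.cover p _) (vertex-closed⁻¹ (CPP.perm p) ν vertex x x∈ν) w≤k)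

locS-⊆ : ∀ (ν : Subset n) p p' → locS ν p ⊆ locS ν p'
locS-⊆ ν p p' y∈t = locS-complete ν p' (locS-inside ν p y∈t)

module _ {n : ℕ} (p p' : CPP n) where

  private
    w w' : List (Fin n)
    w  = CPP.word p
    w' = CPP.word p'
    P P' : Permutation′ n
    P  = CPP.perm p
    P' = CPP.perm p'
    s s' π π' π⁻¹ π'⁻¹ D D' : Fin n → Fin n
    s    = cyc w
    s'   = cyc w'
    π    = P ⟨$⟩ʳ_
    π'   = P' ⟨$⟩ʳ_
    π⁻¹  = P ⟨$⟩ˡ_
    π'⁻¹ = P' ⟨$⟩ˡ_
    D    = diag w π⁻¹
    D'   = diag w' π'⁻¹

  SameDiagonal : Set
  SameDiagonal = ∀ x → D x ≡ D' x

  -- Acting by H permutes the diagonal-pairs, so it preserves the diagonal: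
  -- π' = π ∘ s⁻¹ ∘ s^H gives s^H ∘ π'⁻¹ = s ∘ π⁻¹.
  action-sameDiagonal : ∀ H → IsAction p H p' → SameDiagonal
  action-sameDiagonal H (w'≡w^H , π'≡π^H) x = begin
    s (π⁻¹ x)                              ≡⟨ cong (λ y → s (π⁻¹ y)) (inverseʳ P') ⟨
    s (π⁻¹ (π' (π'⁻¹ x)))                  ≡⟨ cong (λ y → s (π⁻¹ y)) (π'≡π^H (π'⁻¹ x)) ⟩
    s (π⁻¹ (π (cycInv w (s^H (π'⁻¹ x)))))  ≡⟨ cong s (inverseˡ P) ⟩
    s (cycInv w (s^H (π'⁻¹ x)))            ≡⟨ cyc-cycInv w (CPP.uniq p) _ ⟩
    s^H (π'⁻¹ x)                           ≡⟨ cong (λ v → cyc v (π'⁻¹ x)) w'≡w^H ⟨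
    s' (π'⁻¹ x)                            ∎
    where
    open ≡-Reasoning
    s^H : Fin n → Fin n
    s^H = cyc (actWord w H)

  -- With equal diagonals, s and s' agree wherever π and π' do: s y = D (π y) = s' y.
  sameDiagonal-cycles : SameDiagonal → ∀ y → π y ≡ π' y → s y ≡ s' y
  sameDiagonal-cycles sameD y πy≡π'y = begin
    s y          ≡⟨ cong s (inverseˡ P) ⟨
    D (π y)      ≡⟨ sameD (π y) ⟩
    D' (π y)     ≡⟨ cong D' πy≡π'y ⟩
    D' (π' y)    ≡⟨ cong s' (inverseˡ P') ⟩
    s' y         ∎
    where open ≡-Reasoning

  -- If moreover π and π' differ only on a common vertex ν, then the localized diagonals
  -- coincide: both are the first return to ν of D = D', along s resp. s', and s and s'
  -- agree outside ν.
  sameDiagonal-local : SameDiagonal → ∀ ν → IsVertex P ν → IsVertex P' ν → (∀ i → i ∉ ν → π i ≡ π' i) →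
                       ∀ x → x ∈ ν → locD ν p x ≡ locD ν p' x
  sameDiagonal-local sameD ν vertex vertex' agree x x∈ν = begin
    locD ν p x                        ≡⟨ locD-firstReturn ν p vertex k (m≤m+n _ _) x x∈ν ⟩
    firstReturn ν s k (D x)           ≡⟨ cong (firstReturn ν s k) (sameD x) ⟩
    firstReturn ν s k (D' x)          ≡⟨ firstReturn-cong ν s s' (λ i i∉ν → sameDiagonal-cycles sameD i (agree i i∉ν)) k _ ⟩
    firstReturn ν s' k (D' x)         ≡⟨ locD-firstReturn ν p' vertex' k (m≤n+m _ _) x x∈ν ⟨
    locD ν p' x                       ∎
    where
    open ≡-Reasoning
    k : ℕ
    k = length w + length w'

  -- If the localized diagonals agree on the common vertex ν and s'_ν = s_ν^h, then
  -- π'_ν = π_ν^h on ν, as both are D_ν⁻¹ ∘ s'_ν there.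
  localized-action : ∀ ν (h : Permutation′ (length (drop 1 (locS ν p)))) → IsVertex P ν → IsVertex P' ν →
                     (∀ x → x ∈ ν → locD ν p x ≡ locD ν p' x) →
                     (∀ x → cyc (locS ν p') x ≡ cyc (actWord (locS ν p) h) x) →
                     ∀ x → x ∈ ν → locπ ν p' x ≡ actPerm (locS ν p) (locπ ν p) h x
  localized-action ν h vertex vertex' sameD s'ν≡s^h x x∈ν = begin
    locπ ν p' x                              ≡⟨ restr-in ν π' x x∈ν ⟩
    π' x                                     ≡⟨ inverseʳ P ⟨
    π (π⁻¹ (π' x))                           ≡⟨ restr-in ν π _ π⁻¹π'x∈ν ⟨
    restr ν π (π⁻¹ (π' x))                   ≡⟨ cong (restr ν π) π⁻¹π'x≡ ⟩
    restr ν π (cycInv t (cyc t' x))          ≡⟨ cong (λ y → restr ν π (cycInv t y)) (s'ν≡s^h x) ⟩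
    actPerm t (locπ ν p) h x                 ∎
    where
    open ≡-Reasoning
    t t' : List (Fin n)
    t  = locS ν p
    t' = locS ν p'
    π'x∈ν : π' x ∈ ν
    π'x∈ν = vertex-closed P' ν vertex' x x∈ν
    π⁻¹π'x∈ν : π⁻¹ (π' x) ∈ ν
    π⁻¹π'x∈ν = vertex-closed⁻¹ P ν vertex (π' x) π'x∈ν
    sν-π⁻¹π'x : cyc t (π⁻¹ (π' x)) ≡ cyc t' x
    sν-π⁻¹π'x = begin
      cyc t (π⁻¹ (π' x))     ≡⟨ locD-inside ν p (π' x) π'x∈ν ⟨
      locD ν p (π' x)        ≡⟨ sameD (π' x) π'x∈ν ⟩
      locD ν p' (π' x)       ≡⟨ locD-inside ν p' (π' x) π'x∈ν ⟩
      cyc t' (π'⁻¹ (π' x))   ≡⟨ cong (cyc t') (inverseˡ P') ⟩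
      cyc t' x               ∎
    π⁻¹π'x≡ : π⁻¹ (π' x) ≡ cycInv t (cyc t' x)
    π⁻¹π'x≡ = trans (sym (cycInv-cyc t (locS-unique ν p) _)) (cong (cycInv t) sν-π⁻¹π'x)

lemma2p1 : {n : ℕ} (p p' : CPP n) (H : Permutation′ (length (drop 1 (CPP.word p)))) (ν : Subset n)
    → IsAction p H p'
    → SamePar (CPP.perm p) (CPP.perm p')
    → IsVertex (CPP.perm p) ν
    → (∀ i → i ∉ ν → CPP.perm p ⟨$⟩ʳ i ≡ CPP.perm p' ⟨$⟩ʳ i)
    → (∃ λ (h : Permutation′ (length (drop 1 (locS ν p))))
         → (∀ x → cyc (locS ν p') x ≡ cyc (actWord (locS ν p) h) x)
         × (∀ x → x ∈ ν → locπ ν p' x ≡ actPerm (locS ν p) (locπ ν p) h x))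
      × (∀ x → x ∈ ν → locD ν p x ≡ locD ν p' x)
      × (∀ x y → x ∈ ν → y ∈ ν → (Reach (locπ ν p) x y ⇔ Reach (locπ ν p') x y))
lemma2p1 p p' H ν action same vertex agree =
  (h , s'ν≡s^h , localized-action p p' ν h vertex vertex' sameLocalD s'ν≡s^h) ,
  sameLocalD ,
  (λ x y x∈ν _ → restr-samePar (CPP.perm p) (CPP.perm p') ν same vertex x y x∈ν)
  where
  vertex' : IsVertex (CPP.perm p') ν
  vertex' = vertex-samePar (CPP.perm p) (CPP.perm p') ν same vertex
  sameLocalD : ∀ x → x ∈ ν → locD ν p x ≡ locD ν p' x
  sameLocalD = sameDiagonal-local p p' (action-sameDiagonal p p' H action) ν vertex vertex' agree
  reordering : ∃ λ (h : Permutation′ (length (drop 1 (locS ν p)))) → ∀ x → cyc (locS ν p') x ≡ cyc (actWord (locS ν p) h) x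
  reordering = cyc-reorder (locS ν p) (locS ν p') (locS-unique ν p) (locS-unique ν p') (locS-⊆ ν p p') (locS-⊆ ν p' p)
  h : Permutation′ (length (drop 1 (locS ν p)))
  h = proj₁ reordering
  s'ν≡s^h : ∀ x → cyc (locS ν p') x ≡ cyc (actWord (locS ν p) h) x
  s'ν≡s^h = proj₂ reordering
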